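{- Let $Q$ be a finite alphabet, $Z$ a countable set, $\phi:Q^Z\to Q$ and $x,y\in Q^Z$. (1) If there exists a finite $v\subseteq Z$ such that $\phi(x_{Z\setminus v},y_v)=\phi(y)$, then there exists a finite influence of $\phi$ for $(x,y)$. Now let $u\subseteq Z$ be an influence of $\phi$ for $(x,y)$. Then: (2) $u\subseteq\Delta(x,y):=\{i\in Z: x_i\ne y_i\}$; (3) $u=\emptyset$ if and only if $\phi(x)=\phi(y)$; (4) for any $t\subseteq u$ there exists $z\in Q^Z$ such that $t$ is an influence of $\phi$ for $(z,y)$.
   Context: For $x,y\in Q^Z$ and $s\subseteq Z$, $(x_{Z\setminus s},y_s)$ denotes the configuration equal to $y$ on $s$ and to $x$ on $Z\setminus s$. A set $u\subseteq Z$ is an influence of $\phi$ for the ordered pair $(x,y)$ if $\phi(x_{Z\setminus u},y_u)=\phi(y)$ and $\phi(x_{Z\setminus t},y_t)\ne\phi(y)$ for every proper subset $t\subsetneq u$. -}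

module Defs where

open import Data.Nat using (ℕ)
open import Data.Fin using (Fin)
open import Data.Bool using (Bool; true; false; if_then_else_)
open import Data.List using (List)
open import Data.List.Membership.Propositional using (_∈_)
open import Data.Product using (Σ; ∃; _×_)
open import Data.Empty using (⊥)
open import Relation.Nullary using (¬_)
open import Relation.Binary.PropositionalEquality using (_≡_; _≢_)
open import Function.Bundles using (_↔_)
open import Function.Definitions using (Injective)

IsFinite : Set → Set
IsFinite Q = Σ ℕ λ n → Q ↔ Fin n

IsCountable : Set → Set
IsCountable Z = Σ (Z → ℕ) λ f → Injective _≡_ _≡_ f

Subset : Set → Set
Subset Z = Z → Bool

module _ {Z : Set} where

  _⊆_ : Subset Z → Subset Z → Set
  t ⊆ u = ∀ i → t i ≡ true → u i ≡ true

  _⊊_ : Subset Z → Subset Z → Set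
  t ⊊ u = t ⊆ u × ∃ λ i → u i ≡ true × t i ≡ false

  IsEmpty : Subset Z → Set
  IsEmpty u = ∀ i → u i ≡ false

  IsFiniteSubset : Subset Z → Set
  IsFiniteSubset v = ∃ λ (xs : List Z) → ∀ i → v i ≡ true → i ∈ xs

  Δ : {Q : Set} → (Z → Q) → (Z → Q) → Z → Set
  Δ x y i = x i ≢ y i

  -- (x_{Z∖s}, y_s): equal to y on s and to x elsewhere
  patch : {Q : Set} → (Z → Q) → (Z → Q) → Subset Z → (Z → Q)
  patch x y s i = if s i then y i else x i

  IsInfluence : {Q : Set} → ((Z → Q) → Q) → (Z → Q) → (Z → Q) → Subset Z → Set
  IsInfluence φ x y u =
    (φ (patch x y u) ≡ φ y) × (∀ t → t ⊊ u → φ (patch x y t) ≢ φ y)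

module Submission where

-- The proof is a small theory of minimal sets of a
-- predicate P on subsets of Z (subsets are Boolean characteristic functions,
-- and P is invariant under pointwise equality of subsets):
--   * minimal-∅ and minimal-restrict are the order-theoretic content of
--     parts (3) and (4): a minimal set is empty as soon as P ∅ holds, and a
--     subset t of a minimal set u is minimal for the shifted predicate
--     P(· ∪ (u ∖ t));
--   * minimal-or-none is the content of part (1): by induction on a list xs,
--     a decidable P either has a minimal set supported in xs or holds for no
--     set supported in xs; the step for k ∷ xs first searches the sets
--     avoiding k, then the sets containing k;
--   * part (2) holds because u ∖ {i} has the same patch as u when x i = y i.
-- Finiteness of Q and countability of Z are used only to decide equality,
-- which makes φ(x_{Z∖s}, y_s) = φ(y) decidable and singletons {k} definable.

open import Defs
open import Data.Bool using (true; false; _∧_; _∨_; not)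
open import Data.Bool.Properties using (∨-identityʳ; ∨-zeroʳ; ∧-identityʳ; ∧-zeroʳ)
open import Data.Product using (∃; _×_; _,_; proj₁)
open import Data.Sum using (_⊎_; inj₁; inj₂)
open import Data.List using (List; []; _∷_)
open import Data.List.Relation.Unary.Any using (here; there)
open import Data.List.Membership.Propositional using (_∈_)
open import Data.Empty using (⊥; ⊥-elim)
open import Relation.Nullary using (¬_; yes; no; does)
open import Relation.Nullary.Decidable using (via-injection)
open import Relation.Unary using (Decidable)
open import Relation.Binary.Definitions using (DecidableEquality)
open import Relation.Binary.PropositionalEquality
  using (_≡_; _≢_; _≗_; refl; sym; trans; cong)
open import Function.Bundles using (_⇔_; mk⇔; mk↣; Equivalence)
open import Function.Properties.Inverse using (↔⇒↣)
import Data.Fin as Fin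
import Data.Nat as ℕ

finite⇒decEq : {Q : Set} → IsFinite Q → DecidableEquality Q
finite⇒decEq (_ , Q↔Fin) = via-injection (↔⇒↣ Q↔Fin) Fin._≟_

countable⇒decEq : {Z : Set} → IsCountable Z → DecidableEquality Z
countable⇒decEq (_ , injective) = via-injection (mk↣ injective) ℕ._≟_

true-and-false : ∀ {b} → b ≡ true → b ≡ false → ⊥
true-and-false refl ()

module SubsetAlgebra {Z : Set} where

  ∅ : Subset Z
  ∅ _ = false

  _∪_ : Subset Z → Subset Z → Subset Z
  (s ∪ t) j = s j ∨ t j

  _∖_ : Subset Z → Subset Z → Subset Z
  (s ∖ t) j = s j ∧ not (t j)

  infixl 30 _∪_ _∖_

  ∖-⊆ : ∀ {s t} → s ∖ t ⊆ s
  ∖-⊆ {s} j e with s j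
  ... | true  = refl
  ... | false = e

  ∅-⊊ : ∀ {u i} → u i ≡ true → ∅ ⊊ u
  ∅-⊊ {i = i} ui = (λ _ ()) , i , ui , refl

  ∪-∖-⊆ : ∀ {t u} → t ⊆ u → t ∪ (u ∖ t) ≗ u
  ∪-∖-⊆ {t} {u} t⊆u j with t j in tj
  ... | true  = sym (t⊆u j tj)
  ... | false = ∧-identityʳ (u j)

  ∪-∖-⊊ : ∀ {s t u} → t ⊆ u → s ⊊ t → s ∪ (u ∖ t) ⊊ u
  ∪-∖-⊊ {s} {t} {u} t⊆u (s⊆t , i , ti , si) = ⊆u , i , t⊆u i ti , missing
    where
    ⊆u : s ∪ (u ∖ t) ⊆ u
    ⊆u j e with s j in sj
    ... | true  = t⊆u j (s⊆t j sj)
    ... | false = ∖-⊆ {s = u} {t} j e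
    missing : (s ∪ (u ∖ t)) i ≡ false
    missing rewrite si | ti = ∧-zeroʳ (u i)

module MinimalSets {Z : Set} where

  open SubsetAlgebra

  Respects : (Subset Z → Set) → Set
  Respects P = ∀ {s t} → s ≗ t → P s → P t

  Minimal : (Subset Z → Set) → Subset Z → Set
  Minimal P u = P u × (∀ t → t ⊊ u → ¬ P t)

  minimal-⇔ : ∀ {P P′ u} → (∀ s → P s ⇔ P′ s) → Minimal P u → Minimal P′ u
  minimal-⇔ P⇔P′ (Pu , min) =
    Equivalence.to (P⇔P′ _) Pu ,
    λ t t⊊u P′t → min t t⊊u (Equivalence.from (P⇔P′ t) P′t)

  minimal-∅ : ∀ {P u} → Minimal P u → P ∅ → IsEmpty u
  minimal-∅ {u = u} (_ , min) P∅ i with u i in ui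
  ... | false = refl
  ... | true  = ⊥-elim (min ∅ (∅-⊊ ui) P∅)

  minimal-restrict : ∀ {P u t} → Respects P → Minimal P u → t ⊆ u →
                     Minimal (λ s → P (s ∪ (u ∖ t))) t
  minimal-restrict resp (Pu , min) t⊆u =
    resp (λ j → sym (∪-∖-⊆ t⊆u j)) Pu , λ s s⊊t → min _ (∪-∖-⊊ t⊆u s⊊t)

module Search {Z : Set} (_≟_ : DecidableEquality Z) where

  open SubsetAlgebra
  open MinimalSets

  ⁅_⁆ : Z → Subset Z
  ⁅ k ⁆ j = does (j ≟ k)

  Supported : List Z → Subset Z → Set
  Supported xs s = ∀ i → s i ≡ true → i ∈ xs

  ⁅⁆-self : ∀ k → ⁅ k ⁆ k ≡ true
  ⁅⁆-self k with k ≟ k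
  ... | yes _   = refl
  ... | no k≢k = ⊥-elim (k≢k refl)

  ⁅⁆-other : ∀ {j k} → j ≢ k → ⁅ k ⁆ j ≡ false
  ⁅⁆-other {j} {k} j≢k with j ≟ k
  ... | yes j≡k = ⊥-elim (j≢k j≡k)
  ... | no _    = refl

  ∪⁅⁆-other : ∀ {u j k} → j ≢ k → (u ∪ ⁅ k ⁆) j ≡ u j
  ∪⁅⁆-other {u} {j} j≢k rewrite ⁅⁆-other j≢k = ∨-identityʳ (u j)

  ∖⁅⁆-self : ∀ t k → (t ∖ ⁅ k ⁆) k ≡ false
  ∖⁅⁆-self t k rewrite ⁅⁆-self k = ∧-zeroʳ (t k)

  ∖⁅⁆-⊊ : ∀ {u i} → u i ≡ true → u ∖ ⁅ i ⁆ ⊊ u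
  ∖⁅⁆-⊊ {u} {i} ui = ∖-⊆ , i , ui , ∖⁅⁆-self u i

  ∖⁅⁆-∪⁅⁆ : ∀ {t k} → t k ≡ true → t ∖ ⁅ k ⁆ ∪ ⁅ k ⁆ ≗ t
  ∖⁅⁆-∪⁅⁆ {t} {k} tk j with j ≟ k
  ... | yes refl = trans (∨-zeroʳ _) (sym tk)
  ... | no _     = trans (∨-identityʳ _) (∧-identityʳ (t j))

  ⊆-∪⁅⁆ : ∀ {t u k} → t ⊆ u ∪ ⁅ k ⁆ → t k ≡ false → t ⊆ u
  ⊆-∪⁅⁆ {u = u} {k} t⊆ tk j tj with j ≟ k
  ... | yes refl = ⊥-elim (true-and-false tj tk)
  ... | no j≢k   = trans (sym (∪⁅⁆-other {u} j≢k)) (t⊆ j tj)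

  ⊊-∪⁅⁆ : ∀ {t u k} → t ⊊ u ∪ ⁅ k ⁆ → t k ≡ true → t ∖ ⁅ k ⁆ ⊊ u
  ⊊-∪⁅⁆ {t} {u} {k} (t⊆ , i , ui∨ , ti) tk = ⊆u , i , ui , missing
    where
    i≢k : i ≢ k
    i≢k refl = true-and-false tk ti
    ui : u i ≡ true
    ui = trans (sym (∪⁅⁆-other {u} i≢k)) ui∨
    ⊆u : t ∖ ⁅ k ⁆ ⊆ u
    ⊆u j e with j ≟ k
    ... | yes refl = ⊥-elim (true-and-false e (∧-zeroʳ (t j)))
    ... | no j≢k   = trans (sym (∪⁅⁆-other {u} j≢k)) (t⊆ j (trans (sym (∧-identityʳ (t j))) e))
    missing : (t ∖ ⁅ k ⁆) i ≡ false
    missing rewrite ti = refl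

  supported-⊆ : ∀ {xs s t} → t ⊆ s → Supported xs s → Supported xs t
  supported-⊆ t⊆s sup i ti = sup i (t⊆s i ti)

  supported-∪⁅⁆ : ∀ {k ks u} → Supported ks u → Supported (k ∷ ks) (u ∪ ⁅ k ⁆)
  supported-∪⁅⁆ {k} {u = u} sup j e with j ≟ k
  ... | yes refl = here refl
  ... | no _     = there (sup j (trans (sym (∨-identityʳ (u j))) e))

  supported-avoid : ∀ {k ks t} → Supported (k ∷ ks) t → t k ≡ false → Supported ks t
  supported-avoid {k} sup tk j tj with j ≟ k | sup j tj
  ... | yes refl | _         = ⊥-elim (true-and-false tj tk)
  ... | no j≢k   | here j≡k  = ⊥-elim (j≢k j≡k)
  ... | no _     | there j∈ = j∈

  supported-[] : ∀ {t} → Supported [] t → t ≗ ∅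
  supported-[] {t} sup j with t j in tj
  ... | false = refl
  ... | true  with () ← sup j tj

  minimal-or-none : ∀ xs (P : Subset Z → Set) → Respects P → Decidable P →
                    (∃ λ u → Supported xs u × Minimal P u)
                    ⊎ (∀ t → Supported xs t → ¬ P t)
  minimal-or-none [] P resp P? with P? ∅
  ... | yes P∅ = inj₁ (∅ , (λ _ ()) , P∅ , λ { t (_ , _ , () , _) })
  ... | no ¬P∅ = inj₂ λ t sup Pt → ¬P∅ (resp (supported-[] sup) Pt)
  minimal-or-none (k ∷ ks) P resp P? with minimal-or-none ks P resp P?
  ... | inj₁ (u , sup , min) = inj₁ (u , (λ i ui → there (sup i ui)) , min)
  ... | inj₂ noneP with minimal-or-none ks P+k resp+k (λ s → P? (s ∪ ⁅ k ⁆))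
    where
    -- P on the sets containing k, each written as s ∪ {k} with s ⊆ ks
    P+k : Subset Z → Set
    P+k s = P (s ∪ ⁅ k ⁆)
    resp+k : Respects P+k
    resp+k s≗t = resp (λ j → cong (_∨ ⁅ k ⁆ j) (s≗t j))
  ...   | inj₁ (u , sup , Pu , min) =
          inj₁ (u ∪ ⁅ k ⁆ , supported-∪⁅⁆ sup , Pu , min+k)
    where
    min+k : ∀ t → t ⊊ u ∪ ⁅ k ⁆ → ¬ P t
    min+k t t⊊ Pt with t k in tk
    ... | true  = min (t ∖ ⁅ k ⁆) (⊊-∪⁅⁆ t⊊ tk) (resp (λ j → sym (∖⁅⁆-∪⁅⁆ tk j)) Pt)
    ... | false = noneP t (supported-⊆ (⊆-∪⁅⁆ (proj₁ t⊊) tk) sup) Pt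
  ...   | inj₂ noneP+k = inj₂ none
    where
    none : ∀ t → Supported (k ∷ ks) t → ¬ P t
    none t sup Pt with t k in tk
    ... | true  = noneP+k (t ∖ ⁅ k ⁆)
                    (supported-avoid (supported-⊆ ∖-⊆ sup) (∖⁅⁆-self t k))
                    (resp (λ j → sym (∖⁅⁆-∪⁅⁆ tk j)) Pt)
    ... | false = noneP t (supported-avoid sup tk) Pt

module Patching {Z Q : Set} {x y : Z → Q} where

  open SubsetAlgebra

  patch-cong : ∀ {s t} → s ≗ t → patch x y s ≗ patch x y t
  patch-cong s≗t j rewrite s≗t j = refl

  patch-empty : ∀ {u} → IsEmpty u → patch x y u ≗ x
  patch-empty u≡∅ j rewrite u≡∅ j = refl

  patch-∪ : ∀ {w s} → patch (patch x y w) y s ≗ patch x y (s ∪ w)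
  patch-∪ {s = s} j with s j
  ... | true  = refl
  ... | false = refl

module Influence {Q Z : Set} (_≟Q_ : DecidableEquality Q) (_≟Z_ : DecidableEquality Z)
  (φ : (Z → Q) → Q) (φ-ext : ∀ a b → (∀ i → a i ≡ b i) → φ a ≡ φ b)
  (x y : Z → Q) where

  open SubsetAlgebra
  open MinimalSets
  open Search _≟Z_
  open Patching

  -- s is good when patching y into x on s already gives the value φ(y);
  -- an influence is exactly a minimal good set.
  Good : Subset Z → Set
  Good s = φ (patch x y s) ≡ φ y

  good? : Decidable Good
  good? s = φ (patch x y s) ≟Q φ y

  good-respects : Respects Good
  good-respects s≗t good = trans (sym (φ-ext _ _ (patch-cong s≗t))) good

  patch-∖⁅⁆ : ∀ {u i} → x i ≡ y i → patch x y (u ∖ ⁅ i ⁆) ≗ patch x y u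
  patch-∖⁅⁆ {u} {i} xi≡yi j with j ≟Z i
  ... | no _ rewrite ∧-identityʳ (u j) = refl
  ... | yes refl rewrite ∧-zeroʳ (u j) with u j
  ...   | true  = xi≡yi
  ...   | false = refl

  finite-influence : (∃ λ v → IsFiniteSubset v × Good v) →
                     ∃ λ u → IsFiniteSubset u × IsInfluence φ x y u
  finite-influence (v , (xs , sup) , good)
    with minimal-or-none xs Good good-respects good?
  ... | inj₁ (u , sup-u , min) = u , (xs , sup-u) , min
  ... | inj₂ none = ⊥-elim (none v sup good)

  influence⊆Δ : ∀ {u} → IsInfluence φ x y u → ∀ i → u i ≡ true → Δ x y i
  influence⊆Δ (good , min) i ui xi≡yi =
    min _ (∖⁅⁆-⊊ ui) (trans (φ-ext _ _ (patch-∖⁅⁆ xi≡yi)) good)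

  influence-empty : ∀ {u} → IsInfluence φ x y u → IsEmpty u ⇔ (φ x ≡ φ y)
  influence-empty inf@(good , _) =
    mk⇔ (λ u≡∅ → trans (sym (φ-ext _ _ (patch-empty u≡∅))) good) (minimal-∅ inf)

  influence-restrict : ∀ {u t} → IsInfluence φ x y u → t ⊆ u →
                       IsInfluence φ (patch x y (u ∖ t)) y t
  influence-restrict {u} {t} inf t⊆u =
    minimal-⇔ shift (minimal-restrict good-respects inf t⊆u)
    where
    shift : ∀ s → Good (s ∪ (u ∖ t)) ⇔ (φ (patch (patch x y (u ∖ t)) y s) ≡ φ y)
    shift s = mk⇔ (trans same) (trans (sym same))
      where
      same : φ (patch (patch x y (u ∖ t)) y s) ≡ φ (patch x y (s ∪ (u ∖ t)))
      same = φ-ext _ _ (patch-∪ {x = x} {y} {u ∖ t} {s})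

lemma1 : {Q Z : Set} → IsFinite Q → IsCountable Z →
         (φ : (Z → Q) → Q) →
         -- φ is a function on Q^Z: it respects pointwise equality of configurations
         (∀ a b → (∀ i → a i ≡ b i) → φ a ≡ φ b) →
         (x y : Z → Q) →
         ((∃ λ (v : Subset Z) → IsFiniteSubset v × φ (patch x y v) ≡ φ y) →
            ∃ λ (u : Subset Z) → IsFiniteSubset u × IsInfluence φ x y u)
         × (∀ (u : Subset Z) → IsInfluence φ x y u →
              (∀ i → u i ≡ true → Δ x y i)
              × (IsEmpty u ⇔ (φ x ≡ φ y))
              × (∀ t → t ⊆ u → ∃ λ (z : Z → Q) → IsInfluence φ z y t))
lemma1 finQ countZ φ φ-ext x y =
  finite-influence ,
  λ u inf → influence⊆Δ inf , influence-empty inf ,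
            λ t t⊆u → patch x y (u ∖ t) , influence-restrict inf t⊆u
  where
  open SubsetAlgebra using (_∖_)
  open Influence (finite⇒decEq finQ) (countable⇒decEq countZ) φ φ-ext x y
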